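{- Let $(S,\Sigma)$ be a many-sorted signature and consider the hybrid logic $\mathcal{H}_{\Sigma}(@_z)$ described in the context. For every sort $s\in S$ and every formula $\phi$ of sort $s$: if $\vdash_s \phi$ (i.e. $\phi$ is a theorem of sort $s$ of the deductive system of $\mathcal{H}_{\Sigma}(@_z)$), then $\mathcal{M},g,w\models_s\phi$ for every $(S,\Sigma)$-model $\mathcal{M}=(W,(R_\sigma)_{\sigma\in\Sigma},V)$, every assignment $g$ and every $w\in W_s$.
   Context: A many-sorted signature $(S,\Sigma)$ consists of a set $S$ of sorts and a set $\Sigma$ of operation symbols, each with a type $\sigma:s_1\cdots s_n\to s$ ($n\ge 0$); $\Sigma_{s_1\cdots s_n,s}$ is the set of symbols of that type. Fix countable $S$-sorted sets $\mathrm{PROP}=\{\mathrm{PROP}_s\}$ (propositional variables, each $\mathrm{PROP}_s\neq\emptyset$), $\mathrm{NOM}=\{\mathrm{NOM}_s\}$ (nominals) and $\mathrm{SVAR}=\{\mathrm{SVAR}_s\}$ (state variables), with all these sets pairwise disjoint (for distinct sorts and kinds). A state symbol of sort $s$ is an element of $\mathrm{NOM}_s\cup\mathrm{SVAR}_s$. Formulas of $\mathcal{H}_{\Sigma}(@_z)$ of sort $s$: $\phi_s ::= p\mid j\mid x\mid \neg\phi_s\mid \phi_s\vee\phi_s\mid \sigma(\phi_{s_1},\ldots,\phi_{s_n})\mid @^s_z\psi$, where $p\in\mathrm{PROP}_s$, $j\in\mathrm{NOM}_s$, $x\in\mathrm{SVAR}_s$, $\sigma\in\Sigma_{s_1\cdots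 s_n,s}$, and in the last clause $z$ is a state symbol of some sort $t$ and $\psi$ a formula of sort $t$ (so for each $s\in S$, $@^s_z\psi$ is a formula of sort $s$). $\wedge,\to,\leftrightarrow$ are defined as usual, and $\sigma^{\Box}(\phi_1,\ldots,\phi_n):=\neg\sigma(\neg\phi_1,\ldots,\neg\phi_n)$. Semantics: an $(S,\Sigma)$-model is $\mathcal{M}=(W,(R_\sigma)_{\sigma\in\Sigma},V)$ with $W=\{W_s\}_{s\in S}$, each $W_s\neq\emptyset$, $R_\sigma\subseteq W_s\times W_{s_1}\times\cdots\times W_{s_n}$ for $\sigma\in\Sigma_{s_1\cdots s_n,s}$, and $V_s:\mathrm{PROP}_s\cup\mathrm{NOM}_s\to\mathcal{P}(W_s)$ with $V_s(j)$ a singleton for each nominal $j$. An assignment is $g=\{g_s\}$, $g_s:\mathrm{SVAR}_s\to W_s$. For a state symbol $z$, $Den_g(z)$ is the unique element of $V(z)$ if $z$ is a nominal and $g(z)$ if $z$ is a state variable. For $w\in W_s$: $\mathcal{M},g,w\models_s p$ iff $w\in V_s(p)$; $\models_s j$ iff $w\in V_s(j)$; $\models_s x$ iff $w=g_s(x)$; $\neg,\vee$ as usual; $\mathcal{M},g,w\models_s\sigma(\phi_1,\ldots,\phi_n)$ iff there are $w_i\in W_{s_i}$ with $R_\sigma w w_1\cdots w_n$ and $\mathcal{M},g,w_i\models_{s_i}\phi_i$ for all $i$; $\mathcal{M},g,w\models_s @^s_z\psi$ iff $\mathcal{M},g,Den_g(z)\models_t\psi$ ($z,\psi$ of sort $t$).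 Deductive system (theorems of sort $s$ written $\vdash_s\phi$): the least family containing the axioms and closed under the rules below. Axioms: every formula of sort $s$ that is an instance of a propositional tautology; $(K_\sigma)$ $\sigma^\Box(\ldots,\phi\to\chi,\ldots)\to(\sigma^\Box(\ldots,\phi,\ldots)\to\sigma^\Box(\ldots,\chi,\ldots))$ (same other arguments, change in one position $i$); $(Dual_\sigma)$ $\sigma(\psi_1,\ldots,\psi_n)\leftrightarrow\neg\sigma^\Box(\neg\psi_1,\ldots,\neg\psi_n)$; $(K@)$ $@^s_z(\phi\to\psi)\to(@^s_z\phi\to @^s_z\psi)$ ($z,\phi,\psi$ of a common sort $t$); $(SelfDual)$ $@^s_z\phi\leftrightarrow\neg @^s_z\neg\phi$; $(Intro)$ $z\to(\phi\leftrightarrow @^s_z\phi)$ ($z,\phi$ of sort $s$); $(Agree)$ $@^t_y @^{t'}_z\phi\leftrightarrow @^t_z\phi$ ($y$ of sort $t'$, $z,\phi$ of a common sort); $(Ref)$ $@^s_z z$ ($z$ of any sort); $(Back)$ $\sigma(\phi_1,\ldots,\phi_{i-1},@^{s_i}_z\psi,\phi_{i+1},\ldots,\phi_n)\to @^s_z\psi$ for $\sigma\in\Sigma_{s_1\cdots s_n,s}$ and $z,\psi$ of a common sort. Rules: (MP) from $\vdash_s\phi$ and $\vdash_s\phi\to\psi$ infer $\vdash_s\psi$; (UG) from $\vdash_{s_i}\phi$ infer $\vdash_s\sigma^\Box(\phi_1,\ldots,\phi,\ldots,\phi_n)$ ($\phi$ in position $i$, $\sigma\in\Sigma_{s_1\cdots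 s_n,s}$); (BroadcastS) from $\vdash_s @^s_z\phi$ infer $\vdash_{s'}@^{s'}_z\phi$; (Gen@) from $\vdash_{s'}\phi$ infer $\vdash_s @^s_z\phi$ ($z,\phi$ of sort $s'$); (Paste0) from $\vdash_s @^s_z(y\wedge\phi)\to\psi$ infer $\vdash_s @^s_z\phi\to\psi$; (Paste1) from $\vdash_s @^s_z\sigma(\ldots,y\wedge\phi,\ldots)\to\psi$ infer $\vdash_s @^s_z\sigma(\ldots,\phi,\ldots)\to\psi$; in both Paste rules $y$ is a state symbol distinct from $z$ that does not occur in $\phi$ or $\psi$.
   Formalization: In rule (Paste1) the state symbol y must also not occur in the other arguments of σ, besides not occurring in φ and ψ. The statement above fails without it. -}

module Defs where

open import Data.Nat using (ℕ)
open import Data.Bool using (Bool; true; false; not; _∨_)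
open import Data.List using (List; []; _∷_)
open import Data.List.Relation.Unary.All using (All; []; _∷_)
open import Data.Product using (Σ; Σ-syntax; ∃; ∃!; _×_; _,_; proj₁)
open import Data.Sum using (_⊎_)
open import Data.Empty using (⊥)
open import Data.Unit using (⊤)
open import Relation.Nullary using (¬_)
open import Relation.Binary.PropositionalEquality using (_≡_)
open import Function.Definitions using (Injective)

-- An operation symbol σ has type  dom σ → cod σ,
-- i.e. σ ∈ Σ_{s₁⋯sₙ,s} with dom σ = s₁ ∷ ⋯ ∷ sₙ and cod σ = s.
-- Pairwise disjointness of PROP/NOM/SVAR is built in (they are
-- separate types, tagged by separate constructors below).

record Signature : Set₁ where
  field
    Sort  : Set
    Op    : Set
    dom   : Op → List Sort
    cod   : Op → Sort
    PROP  : Sort → Set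
    NOM   : Sort → Set
    SVAR  : Sort → Set
    PROP-countable : ∀ s → Σ (PROP s → ℕ) (Injective _≡_ _≡_)
    NOM-countable  : ∀ s → Σ (NOM s → ℕ) (Injective _≡_ _≡_)
    SVAR-countable : ∀ s → Σ (SVAR s → ℕ) (Injective _≡_ _≡_)
    PROP-nonempty  : ∀ s → PROP s

-- Propositional formulas (for "instance of a propositional tautology")

data PForm : Set where
  patom : ℕ → PForm
  pneg  : PForm → PForm
  por   : PForm → PForm → PForm

evalP : (ℕ → Bool) → PForm → Bool
evalP v (patom n) = v n
evalP v (pneg a)  = not (evalP v a)
evalP v (por a b) = evalP v a ∨ evalP v b

Tautology : PForm → Set
Tautology τ = ∀ (v : ℕ → Bool) → evalP v τ ≡ true

module Hybrid (Sig : Signature) where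
  open Signature Sig

  data StateSym (s : Sort) : Set where
    nom : NOM s → StateSym s
    var : SVAR s → StateSym s

  -- sort-tagged state symbols (to compare symbols of possibly different sorts)
  SomeSym : Set
  SomeSym = Σ Sort StateSym

  mutual
    data Form : Sort → Set where
      prop : ∀ {s} → PROP s → Form s
      sym  : ∀ {s} → StateSym s → Form s
      neg  : ∀ {s} → Form s → Form s
      or   : ∀ {s} → Form s → Form s → Form s
      app  : (σ : Op) → Args (dom σ) → Form (cod σ)
      at   : ∀ {t} (s : Sort) → StateSym t → Form t → Form s

    data Args : List Sort → Set where
      []  : Args []
      _∷_ : ∀ {s ss} → Form s → Args ss → Args (s ∷ ss)

  _⇒_ : ∀ {s} → Form s → Form s → Form s
  φ ⇒ ψ = or (neg φ) ψ

  _∧_ : ∀ {s} → Form s → Form s → Form s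
  φ ∧ ψ = neg (or (neg φ) (neg ψ))

  _⇔_ : ∀ {s} → Form s → Form s → Form s
  φ ⇔ ψ = (φ ⇒ ψ) ∧ (ψ ⇒ φ)

  infixr 5 _⇒_
  infixr 6 _∧_

  negArgs : ∀ {ss} → Args ss → Args ss
  negArgs []       = []
  negArgs (φ ∷ as) = neg φ ∷ negArgs as

  box : (σ : Op) → Args (dom σ) → Form (cod σ)
  box σ as = neg (app σ (negArgs as))

  -- argument tuples with one distinguished position of sort t
  data Hole : List Sort → Sort → Set where
    here  : ∀ {t ss} → Args ss → Hole (t ∷ ss) t
    there : ∀ {s t ss} → Form s → Hole ss t → Hole (s ∷ ss) t

  plug : ∀ {ss t} → Hole ss t → Form t → Args ss
  plug (here as)    φ = φ ∷ as
  plug (there ψ h)  φ = ψ ∷ plug h φ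

  inst : ∀ {s} → (ℕ → Form s) → PForm → Form s
  inst θ (patom n) = θ n
  inst θ (pneg a)  = neg (inst θ a)
  inst θ (por a b) = or (inst θ a) (inst θ b)

  mutual
    Occ : SomeSym → ∀ {s} → Form s → Set
    Occ y (prop p)   = ⊥
    Occ y (sym {s} z) = y ≡ (s , z)
    Occ y (neg φ)    = Occ y φ
    Occ y (or φ ψ)   = Occ y φ ⊎ Occ y ψ
    Occ y (app σ as) = OccArgs y as
    Occ y (at {t} s z φ) = (y ≡ (t , z)) ⊎ Occ y φ

    OccArgs : SomeSym → ∀ {ss} → Args ss → Set
    OccArgs y []       = ⊥
    OccArgs y (φ ∷ as) = Occ y φ ⊎ OccArgs y as

  OccHole : SomeSym → ∀ {ss t} → Hole ss t → Set
  OccHole y (here as)   = OccArgs y as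
  OccHole y (there φ h) = Occ y φ ⊎ OccHole y h

  data ⊢ : (s : Sort) → Form s → Set where
    taut      : ∀ {s} (θ : ℕ → Form s) (τ : PForm) → Tautology τ → ⊢ s (inst θ τ)
    K-σ       : ∀ (σ : Op) {t} (h : Hole (dom σ) t) (φ χ : Form t) →
                ⊢ (cod σ) (box σ (plug h (φ ⇒ χ)) ⇒ (box σ (plug h φ) ⇒ box σ (plug h χ)))
    Dual-σ    : ∀ (σ : Op) (as : Args (dom σ)) →
                ⊢ (cod σ) (app σ as ⇔ neg (box σ (negArgs as)))
    K-at       : ∀ (s : Sort) {t} (z : StateSym t) (φ ψ : Form t) →
                ⊢ s (at s z (φ ⇒ ψ) ⇒ (at s z φ ⇒ at s z ψ))
    SelfDual  : ∀ (s : Sort) {t} (z : StateSym t) (φ : Form t) →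
                ⊢ s (at s z φ ⇔ neg (at s z (neg φ)))
    Intro     : ∀ (s : Sort) (z : StateSym s) (φ : Form s) →
                ⊢ s (sym z ⇒ (φ ⇔ at s z φ))
    Agree     : ∀ (t : Sort) {t' t''} (y : StateSym t') (z : StateSym t'') (φ : Form t'') →
                ⊢ t (at t y (at t' z φ) ⇔ at t z φ)
    Ref       : ∀ (s : Sort) {t} (z : StateSym t) → ⊢ s (at s z (sym z))
    Back      : ∀ (σ : Op) {t} (h : Hole (dom σ) t) {u} (z : StateSym u) (ψ : Form u) →
                ⊢ (cod σ) (app σ (plug h (at t z ψ)) ⇒ at (cod σ) z ψ)
    MP        : ∀ {s} {φ ψ : Form s} → ⊢ s φ → ⊢ s (φ ⇒ ψ) → ⊢ s ψ
    UG        : ∀ (σ : Op) {t} (h : Hole (dom σ) t) {φ : Form t} →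
                ⊢ t φ → ⊢ (cod σ) (box σ (plug h φ))
    BroadcastS : ∀ {s s' t} {z : StateSym t} {φ : Form t} →
                ⊢ s (at s z φ) → ⊢ s' (at s' z φ)
    Gen-at      : ∀ (s : Sort) {s'} (z : StateSym s') {φ : Form s'} →
                ⊢ s' φ → ⊢ s (at s z φ)
    Paste0    : ∀ {s t} (z y : StateSym t) (φ : Form t) (ψ : Form s) →
                ¬ (y ≡ z) → ¬ Occ (t , y) φ → ¬ Occ (t , y) ψ →
                ⊢ s (at s z (sym y ∧ φ) ⇒ ψ) → ⊢ s (at s z φ ⇒ ψ)
    Paste1    : ∀ {s} (σ : Op) {t} (h : Hole (dom σ) t) (z : StateSym (cod σ))
                (y : StateSym t) (φ : Form t) (ψ : Form s) →
                ¬ ((t , y) ≡ (cod σ , z)) → ¬ Occ (t , y) φ → ¬ Occ (t , y) ψ →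
                ¬ OccHole (t , y) h →
                ⊢ s (at s z (app σ (plug h (sym y ∧ φ))) ⇒ ψ) →
                ⊢ s (at s z (app σ (plug h φ)) ⇒ ψ)

  record Model : Set₁ where
    field
      W        : Sort → Set
      W-nonempty : ∀ s → W s
      R        : (σ : Op) → W (cod σ) → All W (dom σ) → Set
      Vprop    : ∀ {s} → PROP s → W s → Set
      Vnom     : ∀ {s} → NOM s → W s → Set
      Vnom-singleton : ∀ {s} (j : NOM s) → ∃! _≡_ (Vnom j)

  Assignment : Model → Set
  Assignment M = ∀ {s} → SVAR s → Model.W M s

  module _ (M : Model) (g : Assignment M) where
    open Model M

    Den : ∀ {s} → StateSym s → W s
    Den (nom j) = proj₁ (Vnom-singleton j)
    Den (var x) = g x

    SatSym : ∀ {s} → StateSym s → W s → Set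
    SatSym (nom j) w = Vnom j w
    SatSym (var x) w = w ≡ g x

    mutual
      Sat : ∀ {s} → W s → Form s → Set
      Sat w (prop p)   = Vprop p w
      Sat w (sym z)    = SatSym z w
      Sat w (neg φ)    = ¬ Sat w φ
      Sat w (or φ ψ)   = Sat w φ ⊎ Sat w ψ
      Sat w (app σ as) = Σ[ ws ∈ All W (dom σ) ] (R σ w ws × SatArgs ws as)
      Sat w (at s z φ) = Sat (Den z) φ

      SatArgs : ∀ {ss} → All W ss → Args ss → Set
      SatArgs []       []       = ⊤
      SatArgs (w ∷ ws) (φ ∷ as) = Sat w φ × SatArgs ws as

-- Every axiom is valid and every rule preserves validity, reasoning classically (the tautologies
-- and the duality of σ and σ^□ need excluded middle).  The only non-routine cases are the Paste
-- rules: given a point satisfying φ (the world denoted by z, resp. a σ-successor of it), change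
-- the interpretation of the fresh symbol y so that it names that point.  As y occurs in neither
-- φ, ψ nor z, a coincidence lemma shows that this affects neither their truth nor the denotation
-- of z, so the premise, valid also in the changed model, yields ψ.

module Submission where

open import Defs
open import Axiom.ExcludedMiddle using (ExcludedMiddle)
open import Level using (0ℓ)
open import Data.Nat using (ℕ)
open import Data.Bool using (Bool; true; false; not; T)
open import Data.Bool.Properties using (T-≡; T-∨)
open import Data.List.Relation.Unary.All using (All; []; _∷_)
open import Data.Product using (Σ; _×_; _,_; proj₁; proj₂; map₂)
open import Data.Product.Function.NonDependent.Propositional using (_×-⇔_)
open import Data.Sum using (_⊎_; inj₁; inj₂)
open import Data.Sum.Function.Propositional using (_⊎-⇔_)
open import Data.Empty using (⊥-elim)
open import Data.Unit using (tt)
open import Function using (_∘_; id)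
open import Function.Bundles using (Equivalence; _⇔_; mk⇔)
import Function.Properties.Equivalence as ⇔
open import Function.Related.TypeIsomorphisms using (→-cong-⇔)
open import Relation.Nullary using (¬_; yes; no)
open import Relation.Nullary.Decidable using (isYes; toWitness; fromWitness)
open import Axiom.DoubleNegationElimination using (em⇒dne)
open import Relation.Binary.PropositionalEquality as ≡ using (_≡_; refl; subst)

open Equivalence using (to; from)

T-not : ∀ b → T (not b) ⇔ (¬ T b)
T-not true  = mk⇔ (λ ()) (λ ¬t → ¬t tt)
T-not false = mk⇔ (λ _ ()) (λ _ → tt)

module Classical (lem : ExcludedMiddle 0ℓ) where

  dne : {A : Set} → ¬ ¬ A → A
  dne = em⇒dne lem

  ¬¬⇔ : {A : Set} → (¬ ¬ A) ⇔ A
  ¬¬⇔ = mk⇔ dne (λ a ¬a → ¬a a)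

  ¬⊎⇔→ : {A B : Set} → (¬ A ⊎ B) ⇔ (A → B)
  ¬⊎⇔→ {A} = mk⇔ elim intro
    where
    elim : ∀ {B} → ¬ A ⊎ B → A → B
    elim (inj₁ ¬a) a = ⊥-elim (¬a a)
    elim (inj₂ b)  _ = b

    intro : ∀ {B} → (A → B) → ¬ A ⊎ B
    intro f with lem {A}
    ... | yes a = inj₂ (f a)
    ... | no ¬a = inj₁ ¬a

  ¬[¬⊎¬]⇔× : {A B : Set} → (¬ (¬ A ⊎ ¬ B)) ⇔ (A × B)
  ¬[¬⊎¬]⇔× = mk⇔ (λ n → dne (n ∘ inj₁) , dne (n ∘ inj₂))
                 (λ { (a , b) (inj₁ ¬a) → ¬a a ; (a , b) (inj₂ ¬b) → ¬b b })

module Soundness (Sig : Signature) (lem : ExcludedMiddle 0ℓ) where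
  open Signature Sig
  open Hybrid Sig renaming (_⇔_ to _⟺_)
  open Classical lem

  -- Equality of sorts need not be decidable, so excluded middle decides whether a′ is the updated point.
  module _ {F G : Sort → Set} where

    _[_≔_] : (∀ {s} → F s → G s) → ∀ {t} → F t → G t → ∀ {s} → F s → G s
    (f [ a ≔ b ]) {s} a′ with lem {_≡_ {A = Σ Sort F} (s , a′) (_ , a)}
    ... | yes refl = b
    ... | no _     = f a′

    update-same : (f : ∀ {s} → F s → G s) {t : Sort} (a : F t) (b : G t) → (f [ a ≔ b ]) {t} a ≡ b
    update-same f {t} a b with lem {_≡_ {A = Σ Sort F} (t , a) (t , a)}
    ... | yes refl = refl
    ... | no a≢a   = ⊥-elim (a≢a refl)

    update-other : (f : ∀ {s} → F s → G s) {t : Sort} (a : F t) (b : G t) {s : Sort} (a′ : F s) →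
                   ¬ _≡_ {A = Σ Sort F} (s , a′) (t , a) → (f [ a ≔ b ]) {s} a′ ≡ f a′
    update-other f {t} a b {s} a′ a′≢a with lem {_≡_ {A = Σ Sort F} (s , a′) (t , a)}
    ... | yes a′≡a = ⊥-elim (a′≢a a′≡a)
    ... | no _     = refl

  holeValue : ∀ {ss t} {B : Sort → Set} → Hole ss t → All B ss → B t
  holeValue (here _)    (b ∷ _)  = b
  holeValue (there _ h) (_ ∷ bs) = holeValue h bs

  negHole : ∀ {ss t} → Hole ss t → Hole ss t
  negHole (here as)    = here (negArgs as)
  negHole (there ψ h)  = there (neg ψ) (negHole h)

  negArgs-plug : ∀ {ss t} (h : Hole ss t) (φ : Form t) → negArgs (plug h φ) ≡ plug (negHole h) (neg φ)
  negArgs-plug (here as)   φ = refl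
  negArgs-plug (there ψ h) φ = ≡.cong (neg ψ ∷_) (negArgs-plug h φ)

  holeValue-negHole : ∀ {ss t} {B : Sort → Set} (h : Hole ss t) (bs : All B ss) →
                      holeValue (negHole h) bs ≡ holeValue h bs
  holeValue-negHole (here _)    (_ ∷ _)  = refl
  holeValue-negHole (there _ h) (_ ∷ bs) = holeValue-negHole h bs

  module _ {M : Model} {g : Assignment M} where
    open Model M

    SatSym⇔Den≡ : ∀ {s} (z : StateSym s) {w : W s} → SatSym M g z w ⇔ (Den M g z ≡ w)
    SatSym⇔Den≡ (nom j) = mk⇔ (proj₂ (proj₂ (Vnom-singleton j)))
                              λ { refl → proj₁ (proj₂ (Vnom-singleton j)) }
    SatSym⇔Den≡ (var x) = mk⇔ ≡.sym ≡.sym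

    Sat-⇒ : ∀ {s} {w : W s} (φ ψ : Form s) → Sat M g w (φ ⇒ ψ) ⇔ (Sat M g w φ → Sat M g w ψ)
    Sat-⇒ _ _ = ¬⊎⇔→

    Sat-∧ : ∀ {s} {w : W s} (φ ψ : Form s) → Sat M g w (φ ∧ ψ) ⇔ (Sat M g w φ × Sat M g w ψ)
    Sat-∧ _ _ = ¬[¬⊎¬]⇔×

    Sat-⟺ : ∀ {s} {w : W s} (φ ψ : Form s) → Sat M g w (φ ⟺ ψ) ⇔ (Sat M g w φ ⇔ Sat M g w ψ)
    Sat-⟺ φ ψ = ⇔.trans (Sat-∧ (φ ⇒ ψ) (ψ ⇒ φ))
                  (mk⇔ (λ (f , b) → mk⇔ (to (Sat-⇒ φ ψ) f) (to (Sat-⇒ ψ φ) b))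
                       (λ e → from (Sat-⇒ φ ψ) (to e) , from (Sat-⇒ ψ φ) (from e)))

    truthValuation : ∀ {s} → W s → (ℕ → Form s) → ℕ → Bool
    truthValuation w θ n = isYes (lem {Sat M g w (θ n)})

    Sat-inst : ∀ {s} (w : W s) (θ : ℕ → Form s) (τ : PForm) →
               Sat M g w (inst θ τ) ⇔ T (evalP (truthValuation w θ) τ)
    Sat-inst w θ (patom n) = mk⇔ fromWitness toWitness
    Sat-inst w θ (pneg a)  = ⇔.trans (→-cong-⇔ (Sat-inst w θ a) ⇔.refl) (⇔.sym (T-not _))
    Sat-inst w θ (por a b) = ⇔.trans (Sat-inst w θ a ⊎-⇔ Sat-inst w θ b) (⇔.sym T-∨)

    SatRest : ∀ {ss t} → All W ss → Hole ss t → Set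
    SatRest (_ ∷ ws) (here as)   = SatArgs M g ws as
    SatRest (w ∷ ws) (there ψ h) = Sat M g w ψ × SatRest ws h

    SatArgs-plug : ∀ {ss t} (h : Hole ss t) (ws : All W ss) {φ : Form t} →
                   SatArgs M g ws (plug h φ) ⇔ (SatRest ws h × Sat M g (holeValue h ws) φ)
    SatArgs-plug (here as)   (w ∷ ws) = mk⇔ (λ (p , r) → r , p) (λ (r , p) → p , r)
    SatArgs-plug (there ψ h) (w ∷ ws) =
      mk⇔ (λ (q , a) → let r , p = to (SatArgs-plug h ws) a in (q , r) , p)
          (λ ((q , r) , p) → q , from (SatArgs-plug h ws) (r , p))

    SatArgs-negArgs² : ∀ {ss} (ws : All W ss) (as : Args ss) →
                       SatArgs M g ws (negArgs (negArgs as)) ⇔ SatArgs M g ws as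
    SatArgs-negArgs² []       []       = ⇔.refl
    SatArgs-negArgs² (w ∷ ws) (φ ∷ as) = ¬¬⇔ ×-⇔ SatArgs-negArgs² ws as

    Sat-box : ∀ σ {t} (h : Hole (dom σ) t) (φ : Form t) {w : W (cod σ)} →
              Sat M g w (box σ (plug h φ)) ⇔
              (∀ ws → R σ w ws → SatRest ws (negHole h) → Sat M g (holeValue h ws) φ)
    Sat-box σ h φ =
      mk⇔ (λ ¬◇ ws r rest → dne λ ¬p → ¬◇ (ws , r , from (negated ws) (rest , ¬p)))
          (λ □ (ws , r , sa) → let rest , ¬p = to (negated ws) sa in ¬p (□ ws r rest))
      where
      negated : ∀ ws → SatArgs M g ws (negArgs (plug h φ)) ⇔
                       (SatRest ws (negHole h) × ¬ Sat M g (holeValue h ws) φ)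
      negated ws rewrite negArgs-plug h φ | ≡.sym (holeValue-negHole h ws) = SatArgs-plug (negHole h) ws

  Valid : ∀ {s} → Form s → Set₁
  Valid φ = ∀ M (g : Assignment M) w → Sat M g w φ

  K-σ-valid : ∀ σ {t} (h : Hole (dom σ) t) (φ χ : Form t) →
              Valid (box σ (plug h (φ ⇒ χ)) ⇒ (box σ (plug h φ) ⇒ box σ (plug h χ)))
  K-σ-valid σ h φ χ M g w =
    from (Sat-⇒ □[ φ ⇒ χ ] (□[ φ ] ⇒ □[ χ ])) λ □φ⇒χ →
    from (Sat-⇒ □[ φ ] □[ χ ]) λ □φ →
    from (Sat-box σ h χ) λ ws r rest →
      to (Sat-⇒ φ χ) (to (Sat-box σ h (φ ⇒ χ)) □φ⇒χ ws r rest) (to (Sat-box σ h φ) □φ ws r rest)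
    where
    □[_] : Form _ → Form (cod σ)
    □[ ψ ] = box σ (plug h ψ)

  Dual-σ-valid : ∀ σ (as : Args (dom σ)) → Valid (app σ as ⟺ neg (box σ (negArgs as)))
  Dual-σ-valid σ as M g w = from (Sat-⟺ (app σ as) (neg (box σ (negArgs as))))
    (⇔.trans (mk⇔ (map₂ (map₂ (from (SatArgs-negArgs² _ as))))
                  (map₂ (map₂ (to (SatArgs-negArgs² _ as)))))
             (⇔.sym ¬¬⇔))

  Intro-valid : ∀ s (z : StateSym s) (φ : Form s) → Valid (sym z ⇒ (φ ⟺ at s z φ))
  Intro-valid s z φ M g w = from (Sat-⇒ (sym z) (φ ⟺ at s z φ)) λ z-at-w →
    from (Sat-⟺ φ (at s z φ))
      (subst (λ u → Sat M g w φ ⇔ Sat M g u φ) (≡.sym (to (SatSym⇔Den≡ z) z-at-w)) ⇔.refl)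

  withNominals : (M : Model) → (∀ {s} → NOM s → Model.W M s) → Model
  withNominals M δ = record M { Vnom = λ j w → δ j ≡ w ; Vnom-singleton = λ j → δ j , refl , id }

  module Coincidence (M : Model) (g : Assignment M) (δ : ∀ {s} → NOM s → Model.W M s)
                     (g′ : Assignment M) (y : SomeSym)
                     (agree : ∀ {s} (z : StateSym s) → ¬ y ≡ (s , z) →
                              Den (withNominals M δ) g′ z ≡ Den M g z) where
    open Model M
    private M′ = withNominals M δ

    mutual
      Sat-coincide : ∀ {s} (φ : Form s) → ¬ Occ y φ → (w : W s) → Sat M′ g′ w φ ⇔ Sat M g w φ
      Sat-coincide (prop p)   _ _ = ⇔.refl
      Sat-coincide (sym z)    n w =
        ⇔.trans (SatSym⇔Den≡ z)
                (subst (λ d → (d ≡ w) ⇔ SatSym M g z w) (≡.sym (agree z n)) (⇔.sym (SatSym⇔Den≡ z)))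
      Sat-coincide (neg φ)    n w = →-cong-⇔ (Sat-coincide φ n w) ⇔.refl
      Sat-coincide (or φ ψ)   n w = Sat-coincide φ (n ∘ inj₁) w ⊎-⇔ Sat-coincide ψ (n ∘ inj₂) w
      Sat-coincide (app σ as) n w =
        mk⇔ (map₂ (map₂ (to (SatArgs-coincide as n _)))) (map₂ (map₂ (from (SatArgs-coincide as n _))))
      Sat-coincide (at s z φ) n w rewrite agree z (n ∘ inj₁) = Sat-coincide φ (n ∘ inj₂) (Den M g z)

      SatArgs-coincide : ∀ {ss} (as : Args ss) → ¬ OccArgs y as → (ws : All W ss) →
                         SatArgs M′ g′ ws as ⇔ SatArgs M g ws as
      SatArgs-coincide []       _ []       = ⇔.refl
      SatArgs-coincide (φ ∷ as) n (w ∷ ws) =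
        Sat-coincide φ (n ∘ inj₁) w ×-⇔ SatArgs-coincide as (n ∘ inj₂) ws

    SatRest-coincide : ∀ {ss t} (h : Hole ss t) → ¬ OccHole y h → (ws : All W ss) →
                       SatRest {M′} {g′} ws h ⇔ SatRest {M} {g} ws h
    SatRest-coincide (here as)   n (_ ∷ ws) = SatArgs-coincide as n ws
    SatRest-coincide (there φ h) n (w ∷ ws) =
      Sat-coincide φ (n ∘ inj₁) w ×-⇔ SatRest-coincide h (n ∘ inj₂) ws

  module _ (M : Model) (g : Assignment M) {t : Sort} where
    open Model M

    variantNominals : StateSym t → W t → ∀ {s} → NOM s → W s
    variantNominals (nom j) d = _[_≔_] {F = NOM} (Den M g ∘ nom) j d
    variantNominals (var _) _ = Den M g ∘ nom

    variantAssignment : (y : StateSym t) (d : W t) → Assignment (withNominals M (variantNominals y d))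
    variantAssignment (nom _) _ = g
    variantAssignment (var x) d = _[_≔_] {F = SVAR} g x d

    Den-variant-self : (y : StateSym t) (d : W t) →
                       Den (withNominals M (variantNominals y d)) (variantAssignment y d) y ≡ d
    Den-variant-self (nom j) d = update-same {F = NOM} (Den M g ∘ nom) j d
    Den-variant-self (var x) d = update-same {F = SVAR} g x d

    Den-variant-other : (y : StateSym t) (d : W t) {s : Sort} (z : StateSym s) → ¬ (t , y) ≡ (s , z) →
                        Den (withNominals M (variantNominals y d)) (variantAssignment y d) z ≡ Den M g z
    Den-variant-other (nom j) d (nom j′) y≢z =
      update-other {F = NOM} (Den M g ∘ nom) j d j′ λ { refl → y≢z refl }
    Den-variant-other (nom j) d (var x)  _   = refl
    Den-variant-other (var x) d (nom j)  _   = refl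
    Den-variant-other (var x) d (var x′) y≢z = update-other {F = SVAR} g x d x′ λ { refl → y≢z refl }

  module Variant (M : Model) (g : Assignment M) {t : Sort} (y : StateSym t) (d : Model.W M t) where
    M′ = withNominals M (variantNominals M g y d)
    g′ = variantAssignment M g y d
    open Coincidence M g (variantNominals M g y d) g′ (t , y) (Den-variant-other M g y d) public

    Sat-variant-named : (φ : Form t) → ¬ Occ (t , y) φ → Sat M g d φ → Sat M′ g′ d (sym y ∧ φ)
    Sat-variant-named φ y∉φ φ-at-d =
      from (Sat-∧ (sym y) φ)
           (from (SatSym⇔Den≡ y) (Den-variant-self M g y d) , from (Sat-coincide φ y∉φ d) φ-at-d)

    conclude-from-variant : ∀ {s} (θ ψ : Form s) {w : Model.W M s} → ¬ Occ (t , y) ψ →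
                            Valid (θ ⇒ ψ) → Sat M′ g′ w θ → Sat M g w ψ
    conclude-from-variant θ ψ {w} y∉ψ premise θ-holds =
      to (Sat-coincide ψ y∉ψ w) (to (Sat-⇒ θ ψ) (premise M′ g′ w) θ-holds)

  Paste0-valid : ∀ {s t} (z y : StateSym t) (φ : Form t) (ψ : Form s) →
                 ¬ y ≡ z → ¬ Occ (t , y) φ → ¬ Occ (t , y) ψ →
                 Valid (at s z (sym y ∧ φ) ⇒ ψ) → Valid (at s z φ ⇒ ψ)
  Paste0-valid {s} z y φ ψ y≢z y∉φ y∉ψ premise M g w = from (Sat-⇒ (at s z φ) ψ) λ φ-at-z →
    let open Variant M g y (Den M g z)
        z-fixed = Den-variant-other M g y (Den M g z) z λ { refl → y≢z refl }
    in conclude-from-variant (at s z (sym y ∧ φ)) ψ y∉ψ premise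
         (subst (λ u → Sat M′ g′ u (sym y ∧ φ)) (≡.sym z-fixed) (Sat-variant-named φ y∉φ φ-at-z))

  Paste1-valid : ∀ {s} σ {t} (h : Hole (dom σ) t) (z : StateSym (cod σ)) (y : StateSym t)
                 (φ : Form t) (ψ : Form s) →
                 ¬ (t , y) ≡ (cod σ , z) → ¬ Occ (t , y) φ → ¬ Occ (t , y) ψ → ¬ OccHole (t , y) h →
                 Valid (at s z (app σ (plug h (sym y ∧ φ))) ⇒ ψ) → Valid (at s z (app σ (plug h φ)) ⇒ ψ)
  Paste1-valid {s} σ h z y φ ψ y≢z y∉φ y∉ψ y∉h premise M g w =
    from (Sat-⇒ (at s z (app σ (plug h φ))) ψ) λ (ws , r , sa) →
      let rest , φ-at-d = to (SatArgs-plug h ws) sa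
          open Variant M g y (holeValue {B = Model.W M} h ws)
          z-fixed = Den-variant-other M g y (holeValue h ws) z y≢z
      in conclude-from-variant (at s z (app σ (plug h (sym y ∧ φ)))) ψ y∉ψ premise
           ( ws
           , subst (λ u → Model.R M σ u ws) (≡.sym z-fixed) r
           , from (SatArgs-plug h ws)
                  (from (SatRest-coincide h y∉h ws) rest , Sat-variant-named φ y∉φ φ-at-d))

  sound : ∀ {s} {φ : Form s} → ⊢ s φ → Valid φ
  sound (taut θ τ tautology) M g w = from (Sat-inst w θ τ) (from T-≡ (tautology (truthValuation w θ)))
  sound (K-σ σ h φ χ)        = K-σ-valid σ h φ χ
  sound (Dual-σ σ as)        = Dual-σ-valid σ as
  sound (K-at s z φ ψ) M g w =
    from (Sat-⇒ {w = w} (at s z (φ ⇒ ψ)) (at s z φ ⇒ at s z ψ)) λ φ⇒ψ →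
      from (Sat-⇒ {w = w} (at s z φ) (at s z ψ)) (to (Sat-⇒ φ ψ) φ⇒ψ)
  sound (SelfDual s z φ) M g w = from (Sat-⟺ {w = w} (at s z φ) (neg (at s z (neg φ)))) (⇔.sym ¬¬⇔)
  sound (Intro s z φ)        = Intro-valid s z φ
  sound (Agree t y z φ) M g w = from (Sat-⟺ {w = w} (at t y (at _ z φ)) (at t z φ)) ⇔.refl
  sound (Ref s z) M g w = from (SatSym⇔Den≡ z) refl
  sound (Back σ h z ψ) M g w =
    from (Sat-⇒ (app σ (plug h (at _ z ψ))) (at (cod σ) z ψ)) λ (ws , _ , sa) →
      proj₂ (to (SatArgs-plug h ws) sa)
  sound (MP {φ = φ} {ψ} ⊢φ ⊢φ⇒ψ) M g w = to (Sat-⇒ φ ψ) (sound ⊢φ⇒ψ M g w) (sound ⊢φ M g w)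
  sound (UG σ h ⊢φ) M g w = from (Sat-box σ h _) λ ws _ _ → sound ⊢φ M g (holeValue h ws)
  sound (BroadcastS {s = s} ⊢at) M g w = sound ⊢at M g (Model.W-nonempty M s)
  sound (Gen-at s z ⊢φ) M g w = sound ⊢φ M g (Den M g z)
  sound (Paste0 z y φ ψ y≢z y∉φ y∉ψ ⊢premise) =
    Paste0-valid z y φ ψ y≢z y∉φ y∉ψ (sound ⊢premise)
  sound (Paste1 σ h z y φ ψ y≢z y∉φ y∉ψ y∉h ⊢premise) =
    Paste1-valid σ h z y φ ψ y≢z y∉φ y∉ψ y∉h (sound ⊢premise)

mainTheorem1 : (Sig : Signature) → ExcludedMiddle 0ℓ →
    (s : Signature.Sort Sig) (φ : Hybrid.Form Sig s) → Hybrid.⊢ Sig s φ →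
    (M : Hybrid.Model Sig) (g : Hybrid.Assignment Sig M) (w : Hybrid.Model.W M s) →
    Hybrid.Sat Sig M g w φ
mainTheorem1 Sig lem s φ ⊢φ = Soundness.sound Sig lem ⊢φ
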